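{- Let $n$ be a positive integer. The complete graph $K_n$ has a $1$-defective incidence $(n-1)$-coloring if and only if there exists an $n\times n$ Latin square without principal intercalates all of whose main-diagonal entries are equal.
   Context: For a graph $G$, an incidence is a pair $(v,e)$ with $v\in V(G)$ an endpoint of the edge $e\in E(G)$; $I(G)$ is the set of all incidences. For $u\in V(G)$ and a neighbor $v$ of $u$, $(u,uv)$ is a strong incidence of $u$ and $(v,uv)$ is a weak incidence of $u$; $I_u$ and $A_u$ denote the sets of strong and weak incidences of $u$. For a map $\varphi$ on $I(G)$, $\varphi(I_u)=\{\varphi(u,uv): v\in N_G(u)\}$. Let $[k]=\{1,\dots,k\}$. A $d$-defective incidence $k$-coloring of $G$ is a map $\varphi: I(G)\to[k]$ such that for every $u\in V(G)$: (a) $\varphi(u,uv)\neq\varphi(u,uw)$ for distinct $v,w\in N_G(u)$; (b) $\varphi(u,uv)\neq\varphi(v,uv)$ for every $v\in N_G(u)$; (c) every color in $\varphi(I_u)$ appears at most $d$ times among the incidences of $A_u$. A Latin square is an $n\times n$ matrix with entries from a set of $n$ symbols in which each symbol appears exactly once in each row and each column. An intercalate is a $2\times 2$ Latin subsquare, i.e. rows $i\neq j$ and columns $k\neq l$ whose four intersection entries involve only two symbols. A principal intercalate is an intercalate whose set of rows equals its set of columns, i.e. rows $i,j$ and columns $i,j$ for some $i\neq j$. -}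

module Defs where

open import Data.Nat using (ℕ; _≤_)
open import Data.Fin using (Fin; _≟_)
open import Data.List using (List; length; filterᵇ; allFin)
open import Data.Bool using (Bool; true; false)
open import Data.Product using (Σ; _×_; ∃; ∃-syntax)
open import Data.Sum using (_⊎_)
open import Relation.Nullary using (¬_; yes; no)
open import Relation.Nullary.Decidable using (⌊_⌋)
open import Relation.Binary.PropositionalEquality using (_≡_; _≢_)

-- In K_n every pair of distinct vertices u, v is adjacent, so the
-- incidence (u, uv) is determined by the ordered pair (u, v) with u ≢ v.
-- A map on I(K_n) with colours in [k] (represented as Fin k) is thus a
-- function taking u, v and an (irrelevant) proof of u ≢ v.

IncMap : ℕ → ℕ → Set
IncMap n k = (u v : Fin n) → .(u ≢ v) → Fin k

-- Number of weak incidences (v, vu) of u, i.e. v ∈ N(u) = {v | v ≢ u},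
-- whose colour is c.
weakHit : ∀ {n k} → IncMap n k → Fin n → Fin k → Fin n → Bool
weakHit {n} φ u c v with v ≟ u
... | yes _ = false
... | no p  = ⌊ φ v u p ≟ c ⌋

countWeak : ∀ {n k} → IncMap n k → Fin n → Fin k → ℕ
countWeak {n} φ u c = length (filterᵇ (weakHit φ u c) (allFin n))

IsDefectiveIncidenceColouring : (d : ℕ) {n k : ℕ} → IncMap n k → Set
IsDefectiveIncidenceColouring d {n} {k} φ =
  ∀ (u : Fin n) →
    (∀ (v w : Fin n) (p : u ≢ v) (q : u ≢ w) → v ≢ w → φ u v p ≢ φ u w q)
  ×
    (∀ (v : Fin n) (p : u ≢ v) (q : v ≢ u) → φ u v p ≢ φ v u q)
  ×
    (∀ (v : Fin n) (p : u ≢ v) → countWeak φ u (φ u v p) ≤ d)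

HasDefectiveIncidenceColouring : (d n k : ℕ) → Set
HasDefectiveIncidenceColouring d n k =
  Σ (IncMap n k) (IsDefectiveIncidenceColouring d)

Matrix : ℕ → Set
Matrix n = Fin n → Fin n → Fin n

IsLatinSquare : ∀ {n} → Matrix n → Set
IsLatinSquare {n} L =
    (∀ (i s : Fin n) → ∃[ j ] (L i j ≡ s × (∀ j' → L i j' ≡ s → j' ≡ j)))
  × (∀ (j s : Fin n) → ∃[ i ] (L i j ≡ s × (∀ i' → L i' j ≡ s → i' ≡ i)))

IsIntercalate : ∀ {n} → Matrix n → (i j k l : Fin n) → Set
IsIntercalate {n} L i j k l =
  i ≢ j × k ≢ l ×
  (Σ (Fin n) λ a → Σ (Fin n) λ b →
     (L i k ≡ a ⊎ L i k ≡ b) × (L i l ≡ a ⊎ L i l ≡ b) ×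
     (L j k ≡ a ⊎ L j k ≡ b) × (L j l ≡ a ⊎ L j l ≡ b))

HasPrincipalIntercalate : ∀ {n} → Matrix n → Set
HasPrincipalIntercalate {n} L = Σ (Fin n) λ i → Σ (Fin n) λ j → IsIntercalate L i j i j

DiagonalConstant : ∀ {n} → Matrix n → Set
DiagonalConstant {n} L = ∀ (i j : Fin n) → L i i ≡ L j j

-- Let φ be a 1-defective incidence (n−1)-colouring of K_n. The n−1 strong incidences of u
-- receive distinct colours from n−1 colours, so every colour occurs at u; defect 1 then
-- forces the n−1 weak incidences of u to be coloured injectively as well. Hence putting
-- φ(u,uv)+1 at (u,v) and 0 on the diagonal gives a Latin square with constant diagonal,
-- and condition (b), φ(u,uv) ≠ φ(v,uv), says exactly that no rows and columns {u,v}
-- carry only two symbols. Conversely, deleting the diagonal symbol of such a Latin square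
-- from the off-diagonal entries yields the colouring.
module Submission where

open import Data.Bool using (T)
open import Data.Bool.Properties using (T?)
open import Data.Empty using (⊥)
open import Data.Fin using (Fin; punchIn; punchOut; _≟_) renaming (zero to fz; suc to fs)
open import Data.Fin.Properties
  using (any?; injective⇒≤; punchIn-injective; punchInᵢ≢i; punchOut-injective; suc-injective)
open import Data.List using ([]; _∷_; length; filter; allFin)
open import Data.List.Membership.Propositional using (_∈_)
open import Data.List.Membership.Propositional.Properties using (∈-allFin; ∈-filter⁺)
open import Data.List.Relation.Unary.All using (All; []; _∷_)
open import Data.List.Relation.Unary.All.Properties using (all-filter)
open import Data.List.Relation.Unary.AllPairs using ([]; _∷_)
open import Data.List.Relation.Unary.Any using (here)
open import Data.List.Relation.Unary.Unique.Propositional using (Unique)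
open import Data.List.Relation.Unary.Unique.Propositional.Properties using (allFin⁺; filter⁺)
open import Data.Nat using (ℕ; zero; suc; _≤_; _∸_; z≤n; s≤s)
open import Data.Nat.Properties using (≤-trans; 1+n≰n)
open import Data.Product using (Σ; _×_; _,_; proj₁; proj₂; ∃-syntax)
open import Data.Sum using (_⊎_; inj₁; inj₂)
open import Defs
open import Function.Base using (_∘_)
open import Function.Bundles using (_⇔_; mk⇔)
open import Function.Definitions using (Injective; StrictlySurjective)
open import Relation.Nullary using (¬_; yes; no; contradiction)
open import Relation.Nullary.Recomputable using (¬-recompute)
open import Relation.Binary.PropositionalEquality using (_≡_; _≢_; refl; sym; trans)
open import Relation.Unary using (Pred; Decidable)

module _ {A : Set} where

  distinct-∈⇒2≤length : ∀ {x y : A} {xs} → x ≢ y → x ∈ xs → y ∈ xs → 2 ≤ length xs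
  distinct-∈⇒2≤length {xs = _ ∷ _ ∷ _} _   _           _           = s≤s (s≤s z≤n)
  distinct-∈⇒2≤length {xs = _ ∷ []}    x≢y (here refl) (here refl) = contradiction refl x≢y

  unique∧all-equal⇒length≤1 : ∀ {ℓ} {P : Pred A ℓ} {xs} → Unique xs → All P xs →
                              (∀ {x y} → P x → P y → x ≡ y) → length xs ≤ 1
  unique∧all-equal⇒length≤1 []              []            _  = z≤n
  unique∧all-equal⇒length≤1 (_ ∷ [])        (_ ∷ [])      _  = s≤s z≤n
  unique∧all-equal⇒length≤1 ((x≢y ∷ _) ∷ _) (px ∷ py ∷ _) eq = contradiction (eq px py) x≢y

  module _ {ℓ} {P : Pred A ℓ} (P? : Decidable P) where

    2≤length-filter : ∀ {x y xs} → x ≢ y → x ∈ xs → y ∈ xs → P x → P y →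
                      2 ≤ length (filter P? xs)
    2≤length-filter x≢y x∈ y∈ px py =
      distinct-∈⇒2≤length x≢y (∈-filter⁺ P? x∈ px) (∈-filter⁺ P? y∈ py)

    length-filter≤1 : ∀ {xs} → Unique xs → (∀ {x y} → P x → P y → x ≡ y) →
                      length (filter P? xs) ≤ 1
    length-filter≤1 {xs} uniq = unique∧all-equal⇒length≤1 (filter⁺ P? uniq) (all-filter P? xs)

injective⇒strictlySurjective : ∀ {n} {f : Fin n → Fin n} →
                               Injective _≡_ _≡_ f → StrictlySurjective _≡_ f
injective⇒strictlySurjective {zero}  _     ()
injective⇒strictlySurjective {suc n} {f} f-inj y with any? (λ x → f x ≟ y)
... | yes hit = hit
... | no ¬hit = contradiction (injective⇒≤ punchOut∘f-inj) 1+n≰n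
  where
  punchOut∘f : Fin (suc n) → Fin n
  punchOut∘f x = punchOut {i = y} λ y≡fx → ¬hit (x , sym y≡fx)

  punchOut∘f-inj : Injective _≡_ _≡_ punchOut∘f
  punchOut∘f-inj eq = f-inj (punchOut-injective {i = y} _ _ eq)

injective⇒unique-preimage : ∀ {n} {f : Fin n → Fin n} → Injective _≡_ _≡_ f →
                            ∀ s → ∃[ x ] (f x ≡ s × (∀ x' → f x' ≡ s → x' ≡ x))
injective⇒unique-preimage f-inj s with injective⇒strictlySurjective f-inj s
... | x , fx≡s = x , fx≡s , λ x' fx'≡s → f-inj (trans fx'≡s (sym fx≡s))

no-three-distinct-in-pair : ∀ {A : Set} {a b x y z : A} → x ≢ y → x ≢ z → y ≢ z →
                            (x ≡ a ⊎ x ≡ b) → (y ≡ a ⊎ y ≡ b) → (z ≡ a ⊎ z ≡ b) → ⊥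
no-three-distinct-in-pair x≢y _   _   (inj₁ refl) (inj₁ refl) _           = x≢y refl
no-three-distinct-in-pair x≢y _   _   (inj₂ refl) (inj₂ refl) _           = x≢y refl
no-three-distinct-in-pair _   x≢z _   (inj₁ refl) (inj₂ refl) (inj₁ refl) = x≢z refl
no-three-distinct-in-pair _   _   y≢z (inj₁ refl) (inj₂ refl) (inj₂ refl) = y≢z refl
no-three-distinct-in-pair _   _   y≢z (inj₂ refl) (inj₁ refl) (inj₁ refl) = y≢z refl
no-three-distinct-in-pair _   x≢z _   (inj₂ refl) (inj₁ refl) (inj₂ refl) = x≢z refl

module _ {n : ℕ} where

  RowInjective ColumnInjective : Matrix n → Set
  RowInjective    L = ∀ i → Injective _≡_ _≡_ (L i)
  ColumnInjective L = ∀ j → Injective _≡_ _≡_ (λ i → L i j)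

  injective⇒latinSquare : ∀ {L} → RowInjective L → ColumnInjective L → IsLatinSquare L
  injective⇒latinSquare rows cols =
    (λ i → injective⇒unique-preimage (rows i)) , (λ j → injective⇒unique-preimage (cols j))

  latinSquare⇒rowInjective : ∀ {L} → IsLatinSquare L → RowInjective L
  latinSquare⇒rowInjective {L} (rows , _) i {j} {j'} eq with rows i (L i j)
  ... | _ , _ , unique = trans (unique j refl) (sym (unique j' (sym eq)))

  latinSquare⇒columnInjective : ∀ {L} → IsLatinSquare L → ColumnInjective L
  latinSquare⇒columnInjective {L} (_ , cols) j {i} {i'} eq with cols j (L i j)
  ... | _ , _ , unique = trans (unique i refl) (sym (unique i' (sym eq)))

module _ {n k : ℕ} (φ : IncMap n k) where

  weakHit⁺ : ∀ {u c v} (p : v ≢ u) → φ v u p ≡ c → T (weakHit φ u c v)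
  weakHit⁺ {u} {c} {v} p φ≡c with v ≟ u
  ... | yes v≡u = contradiction v≡u p
  ... | no  v≢u with φ v u v≢u ≟ c
  ...   | yes _    = _
  ...   | no  φ≢c = φ≢c φ≡c

  weakHit⁻ : ∀ {u c v} → T (weakHit φ u c v) → Σ (v ≢ u) λ p → φ v u p ≡ c
  weakHit⁻ {u} {c} {v} hit with v ≟ u
  ... | no v≢u with φ v u v≢u ≟ c
  ...   | yes φ≡c = v≢u , φ≡c

  -- countWeak is stated with filterᵇ p, which unfolds to filter (T? ∘ p).
  2≤countWeak : ∀ {u c v w} → v ≢ w → (p : v ≢ u) (q : w ≢ u) →
                φ v u p ≡ c → φ w u q ≡ c → 2 ≤ countWeak φ u c
  2≤countWeak {u} {c} v≢w p q φv≡c φw≡c =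
    2≤length-filter (T? ∘ weakHit φ u c) v≢w (∈-allFin _) (∈-allFin _)
      (weakHit⁺ p φv≡c) (weakHit⁺ q φw≡c)

  weak-injective⇒countWeak≤1 : ∀ {u c} →
                               (∀ {v w} (p : v ≢ u) (q : w ≢ u) → φ v u p ≡ φ w u q → v ≡ w) →
                               countWeak φ u c ≤ 1
  weak-injective⇒countWeak≤1 {u} {c} weak-inj =
    length-filter≤1 (T? ∘ weakHit φ u c) (allFin⁺ n) λ hv hw →
      let (p , φv≡c) = weakHit⁻ hv ; (q , φw≡c) = weakHit⁻ hw
      in weak-inj p q (trans φv≡c (sym φw≡c))

module FromColouring {m : ℕ} (φ : IncMap (suc m) m) (φ-colouring : IsDefectiveIncidenceColouring 1 φ) where

  strong-injective : ∀ {u v w} (p : u ≢ v) (q : u ≢ w) → φ u v p ≡ φ u w q → v ≡ w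
  strong-injective {u} {v} {w} p q eq with v ≟ w
  ... | yes v≡w = v≡w
  ... | no  v≢w = contradiction eq (proj₁ (φ-colouring u) v w p q v≢w)

  strongColour : Fin (suc m) → Fin m → Fin m
  strongColour u c = φ u (punchIn u c) (punchInᵢ≢i u c ∘ sym)

  strongColour-injective : ∀ u → Injective _≡_ _≡_ (strongColour u)
  strongColour-injective u {c} {c'} eq =
    punchIn-injective u c c' (strong-injective (punchInᵢ≢i u c ∘ sym) (punchInᵢ≢i u c' ∘ sym) eq)

  countWeak≤1 : ∀ u c → countWeak φ u c ≤ 1
  countWeak≤1 u c with injective⇒strictlySurjective (strongColour-injective u) c
  ... | c' , refl = proj₂ (proj₂ (φ-colouring u)) (punchIn u c') (punchInᵢ≢i u c' ∘ sym)

  weak-injective : ∀ {u v w} (p : v ≢ u) (q : w ≢ u) → φ v u p ≡ φ w u q → v ≡ w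
  weak-injective {u} {v} {w} p q eq with v ≟ w
  ... | yes v≡w = v≡w
  ... | no  v≢w =
    contradiction (≤-trans (2≤countWeak φ v≢w p q refl (sym eq)) (countWeak≤1 u _)) 1+n≰n

  L : Matrix (suc m)
  L i j with i ≟ j
  ... | yes _   = fz
  ... | no  i≢j = fs (φ i j i≢j)

  L-diagonal : ∀ i → L i i ≡ fz
  L-diagonal i with i ≟ i
  ... | yes _   = refl
  ... | no  i≢i = contradiction refl i≢i

  L-offDiagonal : ∀ {i j} (p : i ≢ j) → L i j ≡ fs (φ i j p)
  L-offDiagonal {i} {j} p with i ≟ j
  ... | yes i≡j = contradiction i≡j p
  ... | no  _   = refl

  L-equal-entries : ∀ {i j i' j'} → L i j ≡ L i' j' →
                    (i ≡ j × i' ≡ j') ⊎ Σ (i ≢ j) λ p → Σ (i' ≢ j') λ q → φ i j p ≡ φ i' j' q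
  L-equal-entries {i} {j} {i'} {j'} eq with i ≟ j | i' ≟ j'
  ... | yes i≡j | yes i'≡j' = inj₁ (i≡j , i'≡j')
  ... | no  p   | no  q     = inj₂ (p , q , suc-injective eq)

  L-rowInjective : RowInjective L
  L-rowInjective i eq with L-equal-entries eq
  ... | inj₁ (i≡j , i≡j') = trans (sym i≡j) i≡j'
  ... | inj₂ (p , q , φ≡) = strong-injective p q φ≡

  L-columnInjective : ColumnInjective L
  L-columnInjective j eq with L-equal-entries eq
  ... | inj₁ (i≡j , i'≡j) = trans i≡j (sym i'≡j)
  ... | inj₂ (p , q , φ≡) = weak-injective p q φ≡

  L-noPrincipalIntercalate : ¬ HasPrincipalIntercalate L
  L-noPrincipalIntercalate (i , j , i≢j , _ , a , b , Lii , Lij , Lji , _)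
    rewrite L-diagonal i | L-offDiagonal i≢j | L-offDiagonal (i≢j ∘ sym) =
    no-three-distinct-in-pair (λ ()) (λ ())
      (proj₁ (proj₂ (φ-colouring i)) j i≢j (i≢j ∘ sym) ∘ suc-injective) Lii Lij Lji

  latinSquare : Σ (Matrix (suc m)) λ L → IsLatinSquare L × ¬ HasPrincipalIntercalate L × DiagonalConstant L
  latinSquare = L , injective⇒latinSquare L-rowInjective L-columnInjective , L-noPrincipalIntercalate ,
                λ i j → trans (L-diagonal i) (sym (L-diagonal j))

module FromLatinSquare {m : ℕ} (L : Matrix (suc m)) (latin : IsLatinSquare L)
                       (¬principal : ¬ HasPrincipalIntercalate L) (constant : DiagonalConstant L) where

  D : Fin (suc m)
  D = L fz fz

  L-diagonal : ∀ i → L i i ≡ D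
  L-diagonal i = constant i fz

  L-rowInjective : RowInjective L
  L-rowInjective = latinSquare⇒rowInjective latin

  L-columnInjective : ColumnInjective L
  L-columnInjective = latinSquare⇒columnInjective latin

  D≢offDiagonal : ∀ {i j} → i ≢ j → D ≢ L i j
  D≢offDiagonal {j = j} i≢j D≡Lij =
    i≢j (L-columnInjective j (trans (sym D≡Lij) (sym (L-diagonal j))))

  φ : IncMap (suc m) m
  φ i j i≢j = punchOut (¬-recompute (D≢offDiagonal i≢j))

  φ≡⇒L≡ : ∀ {i j i' j'} (p : i ≢ j) (q : i' ≢ j') → φ i j p ≡ φ i' j' q → L i j ≡ L i' j'
  φ≡⇒L≡ _ _ = punchOut-injective {i = D} _ _

  colouring : IsDefectiveIncidenceColouring 1 φ
  colouring u = strong , opposite , weak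
    where
    strong : ∀ v w (p : u ≢ v) (q : u ≢ w) → v ≢ w → φ u v p ≢ φ u w q
    strong v w p q v≢w eq = v≢w (L-rowInjective u (φ≡⇒L≡ p q eq))

    opposite : ∀ v (p : u ≢ v) (q : v ≢ u) → φ u v p ≢ φ v u q
    opposite v p q eq = ¬principal (u , v , p , p , D , L u v ,
      inj₁ (L-diagonal u) , inj₂ refl , inj₂ (sym (φ≡⇒L≡ p q eq)) , inj₁ (L-diagonal v))

    weak : ∀ v (p : u ≢ v) → countWeak φ u (φ u v p) ≤ 1
    weak _ _ = weak-injective⇒countWeak≤1 φ λ p q eq → L-columnInjective u (φ≡⇒L≡ p q eq)

lemma2 : (n : ℕ) → 1 ≤ n →
    HasDefectiveIncidenceColouring 1 n (n ∸ 1)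
      ⇔ Σ (Matrix n) (λ L → IsLatinSquare L × ¬ HasPrincipalIntercalate L × DiagonalConstant L)
lemma2 (suc m) _ = mk⇔
  (λ (φ , φ-colouring) → FromColouring.latinSquare φ φ-colouring)
  (λ (L , latin , ¬principal , constant) →
    FromLatinSquare.φ L latin ¬principal constant , FromLatinSquare.colouring L latin ¬principal constant)
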